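{- Define $A_1=\{1,2\}$ and, for $n\geq 1$, $A_{n+1}=A_n\cup (A_n+3\max(A_n)-2)$. Then for each positive integer $n$: $|A_n|=2^n$, $\max(A_n)=\frac{4^n+2}{3}$, and $A_n^{ - }\cap 2A_n^{ - }=\emptyset$.
   Context: For $A\subseteq\mathbb{Q}$, $A^-=\{x-y: x,y\in A,\ x\neq y\}$; for $q\in\mathbb{Q}$, $qA=\{qz:z\in A\}$ and $A+q=\{z+q:z\in A\}$. -}

module Defs where

open import Data.Nat using (ℕ; zero; suc; _+_; _*_; _∸_; _⊔_)
import Data.Nat as ℕ
open import Data.Integer using (ℤ; +_; _-_) renaming (_*_ to _*ℤ_)
open import Data.List using (List; []; _∷_; _++_; map; foldr; length; deduplicate)
open import Data.List.Membership.Propositional using (_∈_)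
open import Data.Product using (Σ; ∃; _×_; _,_)
open import Data.Empty using (⊥)
open import Relation.Binary.PropositionalEquality using (_≡_; _≢_)

-- finite sets of positive integers represented by lists of naturals
-- cardinality of the represented set = number of distinct entries
card : List ℕ → ℕ
card xs = length (deduplicate ℕ._≟_ xs)

maxL : List ℕ → ℕ
maxL = foldr _⊔_ 0

shift : ℕ → List ℕ → List ℕ
shift q xs = map (λ z → z + q) xs

step : List ℕ → List ℕ
step xs = xs ++ shift (3 * maxL xs ∸ 2) xs

-- A n for n ≥ 1; A 0 is an unused dummy value
A : ℕ → List ℕ
A zero = []
A (suc zero) = 1 ∷ 2 ∷ []
A (suc (suc n)) = step (A (suc n))

-- d ∈ X⁻  (difference set, differences taken in ℤ ⊆ ℚ)
_∈⁻_ : ℤ → List ℕ → Set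
d ∈⁻ X = Σ ℕ λ x → Σ ℕ λ y → x ∈ X × y ∈ X × x ≢ y × d ≡ (+ x) - (+ y)

_∈2⁻_ : ℤ → List ℕ → Set
d ∈2⁻ X = Σ ℤ λ e → e ∈⁻ X × d ≡ (+ 2) *ℤ e

DiffDisjoint : List ℕ → Set
DiffDisjoint X = ∀ d → d ∈⁻ X → d ∈2⁻ X → ⊥

-- Write the elements of A_{n+1} as z₀ + d s with z₀ ∈ A_n, d ∈ {0,1} and s = 3 max(A_n) − 2.
-- The relation x − y = 2(u − v) reads x + 2v = y + 2u, and x + 2v = (x₀ + 2v₀) + (a + 2e) s
-- with x₀ + 2v₀ ∈ [3, 3 max(A_n)], a window narrower than s.  Comparing both sides in
-- base s forces equal digits, hence x₀ + 2v₀ = y₀ + 2u₀, so by induction x₀ = y₀ and x = y.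
-- Since A_1 = {1} ∪ ({1} + 1), the induction starts from the singleton {1}.
module Submission where

open import Defs
import Data.Nat as ℕ
open import Data.Nat using (ℕ; zero; suc; _+_; _*_; _∸_; _^_; _≤_; _<_; s≤s; z≤n)
open import Data.Nat.Properties
open import Data.Nat.DivMod using (_/_; m*n/n≡m)
open import Data.Nat.Tactic.RingSolver using (solve-∀)
open import Data.Integer as ℤ using (+_; _-_)
import Data.Integer.Properties as ℤ
import Data.Integer.Tactic.RingSolver as ℤ-Solver
open import Data.List using (List; []; _∷_; _++_; length; deduplicate)
open import Data.List.Properties using (length-++; length-map; filter-all)
open import Data.List.Membership.Propositional using (_∈_)
open import Data.List.Membership.Propositional.Properties using (∈-++⁻; ∈-++⁺ʳ; ∈-map⁻; ∈-map⁺)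
open import Data.List.Relation.Unary.Any using (here; there)
open import Data.List.Relation.Unary.All using ([])
open import Data.List.Relation.Unary.Unique.Propositional using (Unique; []; _∷_)
import Data.List.Relation.Unary.Unique.Propositional.Properties as Unique
open import Data.Product using (∃; _×_; _,_; proj₁; proj₂)
open import Data.Sum using (inj₁; inj₂)
open import Data.Empty using (⊥; ⊥-elim)
open import Relation.Binary.PropositionalEquality
  using (_≡_; refl; sym; trans; cong; subst; module ≡-Reasoning)

deduplicate-Unique : ∀ {xs : List ℕ} → Unique xs → deduplicate ℕ._≟_ xs ≡ xs
deduplicate-Unique {[]} [] = refl
deduplicate-Unique {x ∷ xs} (x∉xs ∷ u) rewrite deduplicate-Unique u = cong (x ∷_) (filter-all _ x∉xs)

maxL-lub : ∀ {X M} → (∀ {x} → x ∈ X → x ≤ M) → maxL X ≤ M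
maxL-lub {[]} _ = z≤n
maxL-lub {x ∷ X} ≤M = ⊔-lub (≤M (here refl)) (maxL-lub (λ x∈X → ≤M (there x∈X)))

∈⇒≤maxL : ∀ {X x} → x ∈ X → x ≤ maxL X
∈⇒≤maxL {y ∷ X} (here refl) = m≤m⊔n y (maxL X)
∈⇒≤maxL {y ∷ X} (there x∈X) = ≤-trans (∈⇒≤maxL x∈X) (m≤n⊔m y (maxL X))

3*m≤2+n⇒m≤n : ∀ m n → 3 * m ≤ 2 + n → m ≤ n
3*m≤2+n⇒m≤n zero n _ = z≤n
3*m≤2+n⇒m≤n (suc k) n 3m≤2+n = +-cancelˡ-≤ 2 _ _ (begin
  2 + suc k          ≤⟨ m≤m+n (2 + suc k) (2 * k) ⟩
  2 + suc k + 2 * k  ≡⟨ regroup k ⟩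
  3 * suc k          ≤⟨ 3m≤2+n ⟩
  2 + n              ∎)
  where
  open ≤-Reasoning
  regroup : ∀ k → 2 + suc k + 2 * k ≡ 3 * suc k
  regroup = solve-∀

m≡n+o+p⇒p+n≤m : ∀ {m} n o p → m ≡ n + o + p → p + n ≤ m
m≡n+o+p⇒p+n≤m n o p eq =
  ≤-trans (≤-reflexive (+-comm p n)) (≤-trans (+-monoˡ-≤ p (m≤m+n n o)) (≤-reflexive (sym eq)))

quotient-unique : ∀ {L R s} p q → L < R + s → R < L + s → p * s + L ≡ q * s + R → p ≡ q
quotient-unique zero zero _ _ _ = refl
quotient-unique {s = s} zero (suc q) L<R+s _ eq = ⊥-elim (<⇒≱ L<R+s (m≡n+o+p⇒p+n≤m s (q * s) _ eq))
quotient-unique {s = s} (suc p) zero _ R<L+s eq = ⊥-elim (<⇒≱ R<L+s (m≡n+o+p⇒p+n≤m s (p * s) _ (sym eq)))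
quotient-unique {L} {R} {s} (suc p) (suc q) L<R+s R<L+s eq =
  cong suc (quotient-unique p q L<R+s R<L+s
    (+-cancelˡ-≡ s _ _ (trans (sym (+-assoc s (p * s) L)) (trans eq (+-assoc s (q * s) R)))))

digits-unique : ∀ {a b e c} → a ≤ 1 → b ≤ 1 → e * 2 + a ≡ c * 2 + b → e ≡ c × a ≡ b
digits-unique {a} {b} {e} {c} a≤1 b≤1 eq
  with quotient-unique e c (≤-trans (s≤s a≤1) (m≤n+m 2 b)) (≤-trans (s≤s b≤1) (m≤n+m 2 a)) eq
... | refl = refl , +-cancelˡ-≡ (e * 2) a b eq

∈-++-shift⁻ : ∀ {s X z} → z ∈ X ++ shift s X → ∃ λ z₀ → z₀ ∈ X × ∃ λ d → d ≤ 1 × z ≡ z₀ + d * s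
∈-++-shift⁻ {s} {X} {z} z∈ with ∈-++⁻ X z∈
... | inj₁ z∈X = z , z∈X , 0 , z≤n , sym (+-identityʳ z)
... | inj₂ z∈X+s with ∈-map⁻ (_+ s) z∈X+s
...   | z₀ , z₀∈X , refl = z₀ , z₀∈X , 1 , s≤s z≤n , cong (λ t → z₀ + t) (sym (*-identityˡ s))

regroup-base : ∀ x₀ v₀ a e s → x₀ + a * s + 2 * (v₀ + e * s) ≡ (e * 2 + a) * s + (x₀ + 2 * v₀)
regroup-base = solve-∀

-- X⁻ ∩ 2X⁻ = ∅, with x − y = 2(u − v) rewritten as x + 2v = y + 2u.
DoublingFree : List ℕ → Set
DoublingFree X = ∀ {x y u v} → x ∈ X → y ∈ X → u ∈ X → v ∈ X → x + 2 * v ≡ y + 2 * u → x ≡ y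

module _ {M s : ℕ} {X : List ℕ} (3M≤2+s : 3 * M ≤ 2 + s) (bounded : ∀ {x} → x ∈ X → 1 ≤ x × x ≤ M) where

  ++-shift-bounded : ∀ {z} → z ∈ X ++ shift s X → 1 ≤ z × z ≤ M + s
  ++-shift-bounded z∈ with ∈-++-shift⁻ {s} {X} z∈
  ... | z₀ , z₀∈X , d , d≤1 , refl =
    ≤-trans (proj₁ (bounded z₀∈X)) (m≤m+n z₀ (d * s)) ,
    +-mono-≤ (proj₂ (bounded z₀∈X)) (≤-trans (*-monoˡ-≤ s d≤1) (≤-reflexive (*-identityˡ s)))

  ++-shift-unique : Unique X → Unique (X ++ shift s X)
  ++-shift-unique uX = Unique.++⁺ uX (Unique.map⁺ (+-cancelʳ-≡ _ _ _) uX) disjoint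
    where
    disjoint : ∀ {z} → z ∈ X × z ∈ shift s X → ⊥
    disjoint (z∈X , z∈X+s) with ∈-map⁻ (_+ s) z∈X+s
    ... | w , w∈X , refl = <⇒≱ (+-mono-≤ (proj₁ (bounded w∈X)) (3*m≤2+n⇒m≤n M s 3M≤2+s)) (proj₂ (bounded z∈X))

  weighted-bounds : ∀ {x v} → x ∈ X → v ∈ X → 3 ≤ x + 2 * v × x + 2 * v ≤ 3 * M
  weighted-bounds x∈X v∈X with bounded x∈X | bounded v∈X
  ... | 1≤x , x≤M | 1≤v , v≤M = +-mono-≤ 1≤x (*-monoʳ-≤ 2 1≤v) , +-mono-≤ x≤M (*-monoʳ-≤ 2 v≤M)

  window : ∀ {L R} → L ≤ 3 * M → 3 ≤ R → L < R + s
  window L≤3M 3≤R = ≤-trans (s≤s (≤-trans L≤3M 3M≤2+s)) (+-monoˡ-≤ s 3≤R)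

  digits-agree : ∀ {x₀ y₀ u₀ v₀ a b c e} → x₀ ∈ X → y₀ ∈ X → u₀ ∈ X → v₀ ∈ X → a ≤ 1 → b ≤ 1 →
                 (e * 2 + a) * s + (x₀ + 2 * v₀) ≡ (c * 2 + b) * s + (y₀ + 2 * u₀) →
                 a ≡ b × x₀ + 2 * v₀ ≡ y₀ + 2 * u₀
  digits-agree {b = b} {c} {e} x₀∈ y₀∈ u₀∈ v₀∈ a≤1 b≤1 eq
    with weighted-bounds x₀∈ v₀∈ | weighted-bounds y₀∈ u₀∈
  ... | 3≤L , L≤3M | 3≤R , R≤3M
    with digits-unique {e = e} {c} a≤1 b≤1 (quotient-unique _ _ (window L≤3M 3≤R) (window R≤3M 3≤L) eq)
  ... | refl , refl = refl , +-cancelˡ-≡ ((c * 2 + b) * s) _ _ eq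

  ++-shift-doublingFree : DoublingFree X → DoublingFree (X ++ shift s X)
  ++-shift-doublingFree dfX x∈ y∈ u∈ v∈ eq
    with ∈-++-shift⁻ {s} {X} x∈ | ∈-++-shift⁻ {s} {X} y∈ | ∈-++-shift⁻ {s} {X} u∈ | ∈-++-shift⁻ {s} {X} v∈
  ... | x₀ , x₀∈ , a , a≤1 , refl | y₀ , y₀∈ , b , b≤1 , refl | u₀ , u₀∈ , c , _ , refl | v₀ , v₀∈ , e , _ , refl
    with digits-agree {a = a} {b} {c} {e} x₀∈ y₀∈ u₀∈ v₀∈ a≤1 b≤1
           (trans (sym (regroup-base x₀ v₀ a e s)) (trans eq (regroup-base y₀ u₀ b c s)))
  ... | refl , L≡R = cong (λ t → t + a * s) (dfX x₀∈ y₀∈ u₀∈ v₀∈ L≡R)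

record Admissible (M : ℕ) (X : List ℕ) : Set where
  field
    bounded : ∀ {x} → x ∈ X → 1 ≤ x × x ≤ M
    max∈ : M ∈ X
    unique : Unique X
    doublingFree : DoublingFree X
open Admissible

maxL-Admissible : ∀ {M X} → Admissible M X → maxL X ≡ M
maxL-Admissible adm = ≤-antisym (maxL-lub (λ x∈X → proj₂ (bounded adm x∈X))) (∈⇒≤maxL (max∈ adm))

++-shift-Admissible : ∀ {M s X} → 3 * M ≤ 2 + s → Admissible M X → Admissible (M + s) (X ++ shift s X)
++-shift-Admissible {s = s} {X} 3M≤2+s adm = record
  { bounded = ++-shift-bounded 3M≤2+s (bounded adm)
  ; max∈ = ∈-++⁺ʳ X (∈-map⁺ (_+ s) (max∈ adm))
  ; unique = ++-shift-unique 3M≤2+s (bounded adm) (unique adm)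
  ; doublingFree = ++-shift-doublingFree 3M≤2+s (bounded adm) (doublingFree adm)
  }

step-Admissible : ∀ {M X} → Admissible M X → Admissible (M + (3 * M ∸ 2)) (step X)
step-Admissible {M} {X} adm =
  subst (λ m → Admissible (M + (3 * M ∸ 2)) (X ++ shift (3 * m ∸ 2) X)) (sym (maxL-Admissible adm))
    (++-shift-Admissible (m≤n+m∸n (3 * M) 2) adm)

length-step : ∀ X → length (step X) ≡ 2 * length X
length-step X = trans (length-++ X) (cong (λ t → length X + t) (trans (length-map _ X) (sym (+-identityʳ _))))

-- maxA n is the maximum of A (suc n).
maxA : ℕ → ℕ
maxA zero = 2
maxA (suc n) = maxA n + 4 ^ suc n

3*maxA : ∀ n → 3 * maxA n ≡ 4 ^ suc n + 2
3*maxA zero = refl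
3*maxA (suc n) = begin
  3 * (maxA n + k)     ≡⟨ *-distribˡ-+ 3 (maxA n) k ⟩
  3 * maxA n + 3 * k   ≡⟨ cong (_+ 3 * k) (3*maxA n) ⟩
  k + 2 + 3 * k        ≡⟨ regroup k ⟩
  4 * k + 2            ∎
  where
  open ≡-Reasoning
  k = 4 ^ suc n
  regroup : ∀ k → k + 2 + 3 * k ≡ 4 * k + 2
  regroup = solve-∀

maxA≡ : ∀ n → maxA n ≡ (4 ^ suc n + 2) / 3
maxA≡ n = sym (trans (cong (_/ 3) (trans (sym (3*maxA n)) (*-comm 3 (maxA n)))) (m*n/n≡m (maxA n) 3))

singleton-Admissible : Admissible 1 (1 ∷ [])
singleton-Admissible = record
  { bounded = λ { (here refl) → ≤-refl , ≤-refl }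
  ; max∈ = here refl
  ; unique = [] ∷ []
  ; doublingFree = λ { (here refl) (here refl) _ _ _ → refl }
  }

A-Admissible : ∀ n → Admissible (maxA n) (A (suc n))
A-Admissible zero = step-Admissible singleton-Admissible
A-Admissible (suc n) =
  subst (λ t → Admissible (maxA n + t) (A (suc (suc n)))) (trans (cong (_∸ 2) (3*maxA n)) (m+n∸n≡m _ 2))
    (step-Admissible (A-Admissible n))

length-A : ∀ n → length (A (suc n)) ≡ 2 ^ suc n
length-A zero = refl
length-A (suc n) = trans (length-step (A (suc n))) (cong (2 *_) (length-A n))

m-n≡2[o-p]⇒m+2p≡n+2o : ∀ m n o p → m - n ≡ + 2 ℤ.* (o - p) → m ℤ.+ + 2 ℤ.* p ≡ n ℤ.+ + 2 ℤ.* o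
m-n≡2[o-p]⇒m+2p≡n+2o m n o p eq = begin
  m ℤ.+ + 2 ℤ.* p                       ≡⟨ split m n p ⟩
  (m - n) ℤ.+ (n ℤ.+ + 2 ℤ.* p)         ≡⟨ cong (ℤ._+ (n ℤ.+ + 2 ℤ.* p)) eq ⟩
  + 2 ℤ.* (o - p) ℤ.+ (n ℤ.+ + 2 ℤ.* p) ≡⟨ merge n o p ⟩
  n ℤ.+ + 2 ℤ.* o                       ∎
  where
  open ≡-Reasoning
  split : ∀ m n p → m ℤ.+ + 2 ℤ.* p ≡ (m - n) ℤ.+ (n ℤ.+ + 2 ℤ.* p)
  split = ℤ-Solver.solve-∀
  merge : ∀ n o p → + 2 ℤ.* (o - p) ℤ.+ (n ℤ.+ + 2 ℤ.* p) ≡ n ℤ.+ + 2 ℤ.* o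
  merge = ℤ-Solver.solve-∀

doublingFree⇒DiffDisjoint : ∀ {X} → DoublingFree X → DiffDisjoint X
doublingFree⇒DiffDisjoint dfX _ (x , y , x∈ , y∈ , x≢y , refl) (_ , (u , v , u∈ , v∈ , _ , refl) , eq) =
  x≢y (dfX x∈ y∈ u∈ v∈ (ℤ.+-injective (begin
    + (x + 2 * v)            ≡⟨ cong (λ t → + x ℤ.+ t) (ℤ.pos-* 2 v) ⟩
    + x ℤ.+ + 2 ℤ.* + v      ≡⟨ m-n≡2[o-p]⇒m+2p≡n+2o (+ x) (+ y) (+ u) (+ v) eq ⟩
    + y ℤ.+ + 2 ℤ.* + u      ≡⟨ cong (λ t → + y ℤ.+ t) (ℤ.pos-* 2 u) ⟨
    + (y + 2 * u)            ∎)))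
  where open ≡-Reasoning

lemma2p5 : ∀ (n : ℕ) → 1 ≤ n →
    (card (A n) ≡ 2 ^ n) × (maxL (A n) ≡ (4 ^ n + 2) / 3) × DiffDisjoint (A n)
lemma2p5 (suc n) _ =
  trans (cong length (deduplicate-Unique (unique adm))) (length-A n) ,
  trans (maxL-Admissible adm) (maxA≡ n) ,
  doublingFree⇒DiffDisjoint (doublingFree adm)
  where
  adm : Admissible (maxA n) (A (suc n))
  adm = A-Admissible n
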